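{- There is no real number $c$ such that $Z(L(G))\leq c\,b(G)$ for all finite simple graphs $G$.
   Context: For a finite simple graph $H$: colour each vertex black or white. A black vertex $v$ may force a white neighbour $w$ to become black if $w$ is the only white neighbour of $v$. A set $S\subseteq V(H)$ is a zero-forcing set if, colouring exactly the vertices of $S$ black and repeatedly applying this rule, all vertices eventually become black. The zero-forcing number $Z(H)$ is the minimum size of a zero-forcing set. Brushing: initially every vertex and every edge of $G$ is dirty. An initial configuration places a nonnegative integer number of brushes at each vertex. At each step a single remaining vertex $v$ fires; $v$ may fire only if the number of brushes currently at $v$ is at least the number of dirty edges currently incident with $v$. When $v$ fires, $v$ becomes clean, and along each dirty edge incident with $v$ exactly one brush is moved to the other endpoint, cleaning that edge; the remaining brushes stay at $v$ and play no further role; $v$ and its incident edges are then removed. The process ends when no vertex can fire. A configuration cleans $G$ if some such process cleans all vertices and edges. $b(G)$ is the minimum total number of brushes in a configuration that cleans $G$. $L(G)$ denotes the line graph of $G$: its vertices are the edges of $G$, two being adjacent iff they share an endpoint in $G$.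
   Formalization: The constant c is taken in the rationals rather than the real numbers. -}

module Defs where

open import Data.Nat using (ℕ; zero; suc; _≤_; _<ᵇ_; _+_)
open import Data.Bool using (Bool; true; false; _∧_; _∨_; not; if_then_else_)
open import Data.Fin using (Fin; toℕ; _≟_)
open import Data.Fin.Subset using (Subset; _∈_; _∉_; ⊤; ⊥; ⁅_⁆; _∪_; _∩_; _-_; ∣_∣)
open import Data.Vec using (Vec; tabulate; lookup)
import Data.Vec as Vec
open import Data.List using (List; []; _∷_; concatMap; allFin; length)
import Data.List as List
open import Data.Product using (Σ; _×_; _,_; proj₁; proj₂)
open import Relation.Binary.PropositionalEquality using (_≡_; _≢_)
open import Relation.Nullary.Decidable using (⌊_⌋)

record Graph : Set where
  constructor mkGraph
  field
    n   : ℕ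
    adj : Fin n → Fin n → Bool
open Graph public

record IsSimple (G : Graph) : Set where
  field
    symm    : ∀ u v → adj G u v ≡ adj G v u
    loopless : ∀ v → adj G v v ≡ false

nbhd : (G : Graph) → Fin (n G) → Subset (n G)
nbhd G v = tabulate (adj G v)

edgeList : (G : Graph) → List (Fin (n G) × Fin (n G))
edgeList G = concatMap (λ i → concatMap (λ j →
               if (toℕ i <ᵇ toℕ j) ∧ adj G i j then (i , j) ∷ [] else [])
               (allFin (n G))) (allFin (n G))

_==_ : ∀ {k} → Fin k → Fin k → Bool
a == b = ⌊ a ≟ b ⌋

lineGraph : Graph → Graph
lineGraph G = mkGraph (length es) ladj
  where
  es = edgeList G
  ladj : Fin (length es) → Fin (length es) → Bool
  ladj k l with List.lookup es k | List.lookup es l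
  ... | (a , b) | (c , d) =
    not (k == l) ∧ ((a == c) ∨ (a == d) ∨ (b == c) ∨ (b == d))

data Forcing (H : Graph) : Subset (n H) → Subset (n H) → Set where
  done  : ∀ B → Forcing H B B
  force : ∀ B C v w →
          v ∈ B → w ∉ B → adj H v w ≡ true →
          (∀ u → adj H v u ≡ true → u ≢ w → u ∈ B) →
          Forcing H (B ∪ ⁅ w ⁆) C →
          Forcing H B C

IsZeroForcingSet : (H : Graph) → Subset (n H) → Set
IsZeroForcingSet H S = Forcing H S ⊤

IsZ : (H : Graph) → ℕ → Set
IsZ H k = Σ (Subset (n H)) (λ S → IsZeroForcingSet H S × ∣ S ∣ ≡ k)
        × (∀ S → IsZeroForcingSet H S → k ≤ ∣ S ∣)

-- Cleans G R br : with remaining (dirty) vertex set R and brushes br,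
-- some firing sequence cleans all remaining vertices. The dirty edges are
-- exactly the edges of G with both endpoints in R.
data Cleans (G : Graph) : Subset (n G) → (Fin (n G) → ℕ) → Set where
  finish : ∀ br → Cleans G ⊥ br
  fire   : ∀ R br v → v ∈ R →
           ∣ R ∩ nbhd G v ∣ ≤ br v →
           Cleans G (R - v)
             (λ u → if lookup (R ∩ nbhd G v) u then suc (br u) else br u) →
           Cleans G R br

CleansGraph : (G : Graph) → (Fin (n G) → ℕ) → Set
CleansGraph G br = Cleans G ⊤ br

total : ∀ {k} → (Fin k → ℕ) → ℕ
total f = Vec.sum (tabulate f)

IsB : (G : Graph) → ℕ → Set
IsB G k = Σ (Fin (n G) → ℕ) (λ br → CleansGraph G br × total br ≡ k)
        × (∀ br → CleansGraph G br → k ≤ total br)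

-- The counterexamples are triangle strips G_k: the triangles {2i, 2i+1, 2i+2}, i < k, glued at
-- consecutive vertices. Two brushes at vertex 0 clean G_k when the vertices fire in increasing order.
-- In L(G_k) the three edges of a triangle form a fort (no vertex outside has exactly one neighbour in
-- it), because each endpoint of a triangle edge lies on a second edge of the same triangle. A forcing
-- step can never make the first vertex of a white fort black, so every zero forcing set meets these k
-- disjoint forts: Z(L(G_k)) ≥ k while b(G_k) ≤ 2. The numbers Z and b exist only classically, as least
-- elements of inhabited sets of naturals, which suffices because the claim is a negation.

module Submission where

open import Defs

-- Anonymous, so that the order on ℕ opened here does not clash with the order on ℚ of the statement.
module _ where
  open import Data.Nat using (ℕ; zero; suc; _<_; _≤_; z≤n; s≤s; s≤s⁻¹; _+_; _<ᵇ_; ⌊_/2⌋)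
  import Data.Nat as ℕ
  open import Data.Nat.Induction using (<-rec)
  open import Data.Nat.Properties
    using ( ≮⇒≥; ≰⇒>; <ᵇ⇒<; <⇒<ᵇ; ≤∧≢⇒<; <⇒≤; ≤-refl; ≤-reflexive; ≤-trans; <-trans
          ; <-≤-trans; ≤-<-trans; <-irrefl; n<1+n; n≤1+n; m<n⇒m<1+n; m≤n+m
          ; +-comm; +-suc; +-identityʳ; +-mono-≤; n≡⌊n+n/2⌋ )
  open import Data.Bool using (Bool; true; false; T; if_then_else_; _∧_; _∨_)
  open import Data.Bool.Properties using (T-∧; T-≡; ∨-comm)
  open import Data.Fin using (Fin; toℕ; fromℕ<; zero; suc; _≟_)
  open import Data.Fin.Properties using (any?; toℕ<n; toℕ-injective; toℕ-fromℕ<)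
  open import Data.Fin.Subset
    using (Subset; _∈_; _∉_; ⊤; ⊥; ⁅_⁆; _∪_; _∩_; _-_; ∣_∣; inside; outside)
  open import Data.Fin.Subset.Properties
    using ( _∈?_; ∈⊤; x∈p∪q⁻; x∈⁅y⁆⇒x≡y; x∈p∩q⁺; x∈p∩q⁻; p─q⊆p; x∈p⇒∣p-x∣<∣p∣; x∈p∧x≢y⇒x∈p-y
          ; Empty-unique )
  open import Data.List using ([]; _∷_; length; allFin)
  import Data.List as List
  open import Data.List.Membership.Propositional using (find; lose) renaming (_∈_ to _∈ˡ_)
  open import Data.List.Membership.Propositional.Properties
    using (∈-concatMap⁻; ∈-concatMap⁺; ∈-lookup; ∈-allFin)
  open import Data.List.Relation.Unary.Any using (here; index)
  open import Data.List.Relation.Unary.Any.Properties using (lookup-index)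
  open import Data.Vec using ([]; _∷_; lookup; tabulate; here; there)
  import Data.Vec as Vec
  open import Data.Vec.Properties using ([]=⇒lookup; lookup⇒[]=; lookup∘tabulate)
  open import Data.Product using (Σ; ∃; _×_; _,_; proj₁; proj₂)
  import Data.Product as Product
  open import Data.Sum using (_⊎_; inj₁; inj₂)
  import Data.Sum as Sum
  open import Data.Empty using (⊥-elim)
  open import Function using (Equivalence; _∘_)
  open import Relation.Binary.PropositionalEquality
    using (_≡_; _≢_; refl; sym; trans; cong; cong₂; subst)
  open import Relation.Nullary using (¬_; yes; no)
  open import Relation.Nullary.Decidable using (¬¬-excluded-middle; _×-dec_)
  open import Relation.Unary using (Pred; Decidable)

  Least : (ℕ → Set) → Set
  Least P = ∃ λ m → P m × (∀ {j} → P j → m ≤ j)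

  ¬¬-least : (P : ℕ → Set) {n : ℕ} → P n → ¬ ¬ Least P
  ¬¬-least P = <-rec (λ n → P n → ¬ ¬ Least P) step _
    where
    step : ∀ n → (∀ {j} → j < n → P j → ¬ ¬ Least P) → P n → ¬ ¬ Least P
    step n smaller pn ¬least = ¬¬-excluded-middle {A = ∃ λ j → j < n × P j} λ
      { (yes (j , j<n , pj)) → smaller j<n pj ¬least
      ; (no none) → ¬least (n , pn , λ {j} pj → ≮⇒≥ λ j<n → none (j , j<n , pj)) }

  -- IsZ H = Minimum (IsZeroForcingSet H) ∣_∣ and IsB G = Minimum (CleansGraph G) total.
  Minimum : {X : Set} → (X → Set) → (X → ℕ) → ℕ → Set
  Minimum {X} Q f k = Σ X (λ x → Q x × f x ≡ k) × (∀ x → Q x → k ≤ f x)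

  ¬¬-minimum : {X : Set} (Q : X → Set) (f : X → ℕ) {x : X} → Q x → ¬ ¬ ∃ (Minimum Q f)
  ¬¬-minimum Q f {x} qx ¬min = ¬¬-least (λ m → Σ _ λ y → Q y × f y ≡ m) (x , qx , refl)
    λ (k , witness , least) → ¬min (k , witness , λ y qy → least (y , qy , refl))

  _∈ₑ_ : {A : Set} → A → A × A → Set
  x ∈ₑ (a , b) = x ≡ a ⊎ x ≡ b

  Meet : {A : Set} → A × A → A × A → Set
  Meet e e′ = ∃ λ x → x ∈ₑ e × x ∈ₑ e′

  ∈-if-singleton⁻ : {A : Set} {x y : A} (b : Bool) → y ∈ˡ (if b then x ∷ [] else []) → T b × y ≡ x
  ∈-if-singleton⁻ true (here y≡x) = _ , y≡x

  ∈-if-singleton⁺ : {A : Set} {x : A} (b : Bool) → T b → x ∈ˡ (if b then x ∷ [] else [])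
  ∈-if-singleton⁺ true _ = here refl

  module _ (G : Graph) where

    IsEdge : Fin (n G) × Fin (n G) → Set
    IsEdge (i , j) = toℕ i < toℕ j × adj G i j ≡ true

    ∈-edgeList⁻ : ∀ {e} → e ∈ˡ edgeList G → IsEdge e
    ∈-edgeList⁻ e∈ with find (∈-concatMap⁻ _ {xs = allFin (n G)} e∈)
    ... | i , _ , e∈ᵢ with find (∈-concatMap⁻ _ {xs = allFin (n G)} e∈ᵢ)
    ... | j , _ , e∈ᵢⱼ with ∈-if-singleton⁻ ((toℕ i <ᵇ toℕ j) ∧ adj G i j) e∈ᵢⱼ
    ... | t , refl = let lt , ad = Equivalence.to T-∧ t in
                     <ᵇ⇒< (toℕ i) (toℕ j) lt , Equivalence.to T-≡ ad

    ∈-edgeList⁺ : ∀ {e} → IsEdge e → e ∈ˡ edgeList G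
    ∈-edgeList⁺ {i , j} (i<j , ad) =
      ∈-concatMap⁺ _ {xs = allFin (n G)} (lose (∈-allFin i)
        (∈-concatMap⁺ _ {xs = allFin (n G)} (lose (∈-allFin j)
          (∈-if-singleton⁺ ((toℕ i <ᵇ toℕ j) ∧ adj G i j)
            (Equivalence.from T-∧ (<⇒<ᵇ i<j , Equivalence.from T-≡ ad))))))

    edge : Fin (length (edgeList G)) → Fin (n G) × Fin (n G)
    edge = List.lookup (edgeList G)

    edge-isEdge : ∀ p → IsEdge (edge p)
    edge-isEdge p = ∈-edgeList⁻ (∈-lookup p)

    edge-surjective : ∀ {e} → IsEdge e → ∃ λ p → edge p ≡ e
    edge-surjective e = let e∈ = ∈-edgeList⁺ e in index e∈ , sym (lookup-index e∈)

    private
      meet⁻ : (a b c d : Fin (n G)) → T ((a == c) ∨ (a == d) ∨ (b == c) ∨ (b == d)) → Meet (a , b) (c , d)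
      meet⁻ a b c d t with a ≟ c | a ≟ d | b ≟ c | b ≟ d
      ... | yes a≡c | _       | _       | _       = a , inj₁ refl , inj₁ a≡c
      ... | no _    | yes a≡d | _       | _       = a , inj₁ refl , inj₂ a≡d
      ... | no _    | no _    | yes b≡c | _       = b , inj₂ refl , inj₁ b≡c
      ... | no _    | no _    | no _    | yes b≡d = b , inj₂ refl , inj₂ b≡d

      meet⁺ : (a b c d : Fin (n G)) → Meet (a , b) (c , d) → T ((a == c) ∨ (a == d) ∨ (b == c) ∨ (b == d))
      meet⁺ a b c d m with a ≟ c | a ≟ d | b ≟ c | b ≟ d
      ... | yes _ | _     | _     | _     = _
      ... | no _  | yes _ | _     | _     = _
      ... | no _  | no _  | yes _ | _     = _
      ... | no _  | no _  | no _  | yes _ = _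
      meet⁺ a b c d (_ , inj₁ refl , inj₁ refl) | no a≢c | no _ | no _ | no _ = a≢c refl
      meet⁺ a b c d (_ , inj₁ refl , inj₂ refl) | no _ | no a≢d | no _ | no _ = a≢d refl
      meet⁺ a b c d (_ , inj₂ refl , inj₁ refl) | no _ | no _ | no b≢c | no _ = b≢c refl
      meet⁺ a b c d (_ , inj₂ refl , inj₂ refl) | no _ | no _ | no _ | no b≢d = b≢d refl

    lineGraph-adj⁻ : ∀ p q → adj (lineGraph G) p q ≡ true → p ≢ q × Meet (edge p) (edge q)
    lineGraph-adj⁻ p q e with List.lookup (edgeList G) p | List.lookup (edgeList G) q
    ... | (a , b) | (c , d) with p ≟ q
    ... | no p≢q = p≢q , meet⁻ a b c d (Equivalence.from T-≡ e)

    lineGraph-adj⁺ : ∀ p q → p ≢ q → Meet (edge p) (edge q) → adj (lineGraph G) p q ≡ true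
    lineGraph-adj⁺ p q p≢q m with List.lookup (edgeList G) p | List.lookup (edgeList G) q
    ... | (a , b) | (c , d) with p ≟ q
    ... | yes p≡q = ⊥-elim (p≢q p≡q)
    ... | no _ = Equivalence.to T-≡ (meet⁺ a b c d m)

  module _ (H : Graph) where

    IsFort : Pred (Fin (n H)) _ → Set
    IsFort F = ∀ {v w} → adj H v w ≡ true → F w → ¬ F v →
               ∃ λ u → adj H v u ≡ true × u ≢ w × F u

    fort-stays-white : ∀ {F B C} → IsFort F → Forcing H B C →
                       (∀ {x} → F x → x ∉ B) → ∀ {x} → F x → x ∉ C
    fort-stays-white fort (done B) white = white
    fort-stays-white {F} fort (force B C v w v∈B w∉B v~w others forcing) white =
      fort-stays-white fort forcing white′
      where
      ¬Fw : ¬ F w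
      ¬Fw Fw with fort v~w Fw (λ Fv → white Fv v∈B)
      ... | u , v~u , u≢w , Fu = white Fu (others u v~u u≢w)
      white′ : ∀ {x} → F x → x ∉ B ∪ ⁅ w ⁆
      white′ Fx x∈ with x∈p∪q⁻ B ⁅ w ⁆ x∈
      ... | inj₁ x∈B = white Fx x∈B
      ... | inj₂ x∈w with x∈⁅y⁆⇒x≡y w x∈w
      ... | refl = ¬Fw Fx

    zero-forcing-set-meets-fort : ∀ {F S} → Decidable F → IsFort F → ∃ F →
                                  IsZeroForcingSet H S → ∃ λ x → x ∈ S × F x
    zero-forcing-set-meets-fort {S = S} F? fort (x , Fx) zfs with any? (λ y → (y ∈? S) ×-dec F? y)
    ... | yes meet = meet
    ... | no disjoint = ⊥-elim (fort-stays-white fort zfs (λ Fy y∈S → disjoint (_ , y∈S , Fy)) Fx ∈⊤)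

  hits-labels⇒≤∣p∣ : ∀ {m} (g : Fin m → ℕ) (p : Subset m) k →
                     (∀ {i} → i < k → ∃ λ x → x ∈ p × g x ≡ i) → k ≤ ∣ p ∣
  hits-labels⇒≤∣p∣ g p zero hits = z≤n
  hits-labels⇒≤∣p∣ g p (suc k) hits with hits (n<1+n k)
  ... | x , x∈p , gx≡k = <-≤-trans (s≤s (hits-labels⇒≤∣p∣ g (p - x) k hits′)) (x∈p⇒∣p-x∣<∣p∣ x∈p)
    where
    hits′ : ∀ {i} → i < k → ∃ λ y → y ∈ p - x × g y ≡ i
    hits′ i<k with hits (m<n⇒m<1+n i<k)
    ... | y , y∈p , gy≡i = y , x∈p∧x≢y⇒x∈p-y y∈p (λ { refl → <-irrefl (trans (sym gy≡i) gx≡k) i<k }) , gy≡i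

  zero-forcing-lower-bound : ∀ (H : Graph) (g : Fin (n H) → ℕ) k →
                             (∀ {i} → i < k → IsFort H (λ x → g x ≡ i)) →
                             (∀ {i} → i < k → ∃ λ x → g x ≡ i) →
                             ∀ {S} → IsZeroForcingSet H S → k ≤ ∣ S ∣
  zero-forcing-lower-bound H g k forts nonempty {S} zfs = hits-labels⇒≤∣p∣ g S k λ i<k →
    zero-forcing-set-meets-fort H (λ x → g x ℕ.≟ _) (forts i<k) (nonempty i<k) zfs

  x∉p-x : ∀ {m} (p : Subset m) x → x ∉ p - x
  x∉p-x (_ ∷ p) zero ()
  x∉p-x (_ ∷ p) (suc x) (there x∈) = x∉p-x p x x∈

  ∣p∣≤-range : ∀ {m} (p : Subset m) lo len →
               (∀ {x} → x ∈ p → lo ≤ toℕ x × toℕ x < lo + len) → ∣ p ∣ ≤ len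
  ∣p∣≤-range []            lo       len       _        = z≤n
  ∣p∣≤-range (inside ∷ p)  zero     zero      in-range with () ← proj₂ (in-range here)
  ∣p∣≤-range (inside ∷ p)  zero     (suc len) in-range =
    s≤s (∣p∣≤-range p zero len λ x∈p → z≤n , s≤s⁻¹ (proj₂ (in-range (there x∈p))))
  ∣p∣≤-range (outside ∷ p) zero     len       in-range =
    ∣p∣≤-range p zero len λ x∈p → z≤n , <-trans (n<1+n _) (proj₂ (in-range (there x∈p)))
  ∣p∣≤-range (inside ∷ p)  (suc lo) len       in-range with () ← proj₁ (in-range here)
  ∣p∣≤-range (outside ∷ p) (suc lo) len       in-range =
    ∣p∣≤-range p lo len λ x∈p → let lo≤x , x<hi = in-range (there x∈p) in s≤s⁻¹ lo≤x , s≤s⁻¹ x<hi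

  -- Vertices fire in the order of toℕ; R is the set of those not yet fired.
  Above : ∀ {m} → ℕ → Subset m → Set
  Above j R = (∀ {x} → x ∈ R → j ≤ toℕ x) × (∀ {x} → j ≤ toℕ x → x ∈ R)

  Above-⊤ : ∀ {m} → Above {m} 0 ⊤
  Above-⊤ = (λ _ → z≤n) , (λ _ → ∈⊤)

  Above-remove : ∀ {m j} {R : Subset m} {v} → Above j R → toℕ v ≡ j → Above (suc j) (R - v)
  Above-remove {R = R} {v} (≥j , all) v≡j =
    (λ x∈ → ≤∧≢⇒< (≥j (p─q⊆p R ⁅ v ⁆ x∈)) λ j≡x →
       x∉p-x R v (subst (_∈ R - v) (toℕ-injective (trans (sym j≡x) (sym v≡j))) x∈)) ,
    (λ j<x → x∈p∧x≢y⇒x∈p-y (all (<⇒≤ j<x)) λ { refl → <-irrefl (sym v≡j) j<x })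

  Above-n⇒⊥ : ∀ {m} {R : Subset m} → Above m R → R ≡ ⊥
  Above-n⇒⊥ (≥m , _) = Empty-unique λ (x , x∈R) → <-irrefl refl (<-≤-trans (toℕ<n x) (≥m x∈R))

  module _ (G : Graph) where

    ∈-nbhd⁺ : ∀ {v u} → adj G v u ≡ true → u ∈ nbhd G v
    ∈-nbhd⁺ {v} {u} v~u = lookup⇒[]= u (nbhd G v) (trans (lookup∘tabulate (adj G v) u) v~u)

    ∈-nbhd⁻ : ∀ {v u} → u ∈ nbhd G v → adj G v u ≡ true
    ∈-nbhd⁻ {v} {u} u∈ = trans (sym (lookup∘tabulate (adj G v) u)) ([]=⇒lookup u∈)

    swept : Subset (n G) → Fin (n G) → (Fin (n G) → ℕ) → Fin (n G) → ℕ
    swept R v br u = if lookup (R ∩ nbhd G v) u then suc (br u) else br u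

    swept-neighbour : ∀ {R v u} br → u ∈ R → adj G v u ≡ true → swept R v br u ≡ suc (br u)
    swept-neighbour br u∈R v~u rewrite []=⇒lookup (x∈p∩q⁺ (u∈R , ∈-nbhd⁺ v~u)) = refl

    dirty-edges-bound : IsSimple G → ∀ {j R v} m → Above j R → toℕ v ≡ j →
                        (∀ {x} → j < toℕ x → adj G v x ≡ true → toℕ x ≤ m + j) → ∣ R ∩ nbhd G v ∣ ≤ m
    dirty-edges-bound simple {j} {R} {v} m (≥j , _) v≡j bounded = ∣p∣≤-range _ (suc j) m λ {x} x∈ →
      let x∈R , x∈N = x∈p∩q⁻ R (nbhd G v) x∈
          v~x = ∈-nbhd⁻ x∈N
          j<x = ≤∧≢⇒< (≥j x∈R) λ j≡x → loopless′ (toℕ-injective (trans v≡j j≡x)) v~x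
      in j<x , s≤s (subst (toℕ x ≤_) (+-comm m j) (bounded j<x v~x))
      where
      loopless′ : ∀ {x} → v ≡ x → adj G v x ≢ true
      loopless′ refl v~v with () ← trans (sym v~v) (IsSimple.loopless simple v)

  -- StripEdge (x , y): x < y and {x , y} is an edge of the triangle {2t, 2t+1, 2t+2}, t = ⌊ x /2⌋.
  data StripEdge : ℕ × ℕ → Set where
    e01  : StripEdge (0 , 1)
    e02  : StripEdge (0 , 2)
    e12  : StripEdge (1 , 2)
    next : ∀ {x y} → StripEdge (x , y) → StripEdge (suc (suc x) , suc (suc y))

  isStripEdge : ℕ → ℕ → Bool
  isStripEdge 0 1 = true
  isStripEdge 0 2 = true
  isStripEdge 1 2 = true
  isStripEdge (suc (suc x)) (suc (suc y)) = isStripEdge x y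
  isStripEdge _ _ = false

  isStripEdge-sound : ∀ x y → isStripEdge x y ≡ true → StripEdge (x , y)
  isStripEdge-sound 0 1 _ = e01
  isStripEdge-sound 0 2 _ = e02
  isStripEdge-sound 1 2 _ = e12
  isStripEdge-sound (suc (suc x)) (suc (suc y)) e = next (isStripEdge-sound x y e)
  isStripEdge-sound 0 0 ()
  isStripEdge-sound 0 (suc (suc (suc _))) ()
  isStripEdge-sound 1 0 ()
  isStripEdge-sound 1 1 ()
  isStripEdge-sound 1 (suc (suc (suc _))) ()
  isStripEdge-sound (suc (suc _)) 0 ()
  isStripEdge-sound (suc (suc _)) 1 ()

  isStripEdge-complete : ∀ {x y} → StripEdge (x , y) → isStripEdge x y ≡ true
  isStripEdge-complete e01 = refl
  isStripEdge-complete e02 = refl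
  isStripEdge-complete e12 = refl
  isStripEdge-complete (next e) = isStripEdge-complete e

  StripEdge⇒< : ∀ {x y} → StripEdge (x , y) → x < y
  StripEdge⇒< e01 = s≤s z≤n
  StripEdge⇒< e02 = s≤s z≤n
  StripEdge⇒< e12 = s≤s (s≤s z≤n)
  StripEdge⇒< (next e) = s≤s (s≤s (StripEdge⇒< e))

  isStripEdge-irrefl : ∀ x → isStripEdge x x ≡ false
  isStripEdge-irrefl x with isStripEdge x x in e
  ... | false = refl
  ... | true = ⊥-elim (<-irrefl refl (StripEdge⇒< (isStripEdge-sound x x e)))

  triangle : ℕ → ℕ
  triangle x = ⌊ x /2⌋

  triangle-even : ∀ i → triangle (i + i) ≡ i
  triangle-even i = sym (n≡⌊n+n/2⌋ i)

  triangle-odd : ∀ i → triangle (suc (i + i)) ≡ i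
  triangle-odd zero = refl
  triangle-odd (suc i) rewrite +-suc i i = cong suc (triangle-odd i)

  StripEdge-bounds : ∀ {x y} → StripEdge (x , y) →
                     suc (triangle x + triangle x) ≤ y × y ≤ suc (suc (triangle x + triangle x))
  StripEdge-bounds e01 = ≤-refl , n≤1+n 1
  StripEdge-bounds e02 = n≤1+n 1 , ≤-refl
  StripEdge-bounds e12 = n≤1+n 1 , ≤-refl
  StripEdge-bounds {suc (suc x)} (next e) rewrite +-suc (triangle x) (triangle x) =
    let lower , upper = StripEdge-bounds e in s≤s (s≤s lower) , s≤s (s≤s upper)

  triangle-edges : ∀ i → StripEdge (i + i , suc (i + i)) × StripEdge (i + i , suc (suc (i + i))) ×
                         StripEdge (suc (i + i) , suc (suc (i + i)))
  triangle-edges zero = e01 , e02 , e12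
  triangle-edges (suc i) rewrite +-suc i i =
    let e₁ , e₂ , e₃ = triangle-edges i in next e₁ , next e₂ , next e₃

  OtherEdgeAt : ℕ → ℕ × ℕ → Set
  OtherEdgeAt x e = ∃ λ e′ → StripEdge e′ × triangle (proj₁ e′) ≡ triangle (proj₁ e) × e′ ≢ e × x ∈ₑ e′

  other-edge-next : ∀ {x c d} → OtherEdgeAt x (c , d) → OtherEdgeAt (suc (suc x)) (suc (suc c) , suc (suc d))
  other-edge-next ((c′ , d′) , e′ , same , e′≢e , x∈e′) =
    (suc (suc c′) , suc (suc d′)) , next e′ , cong suc same , (λ { refl → e′≢e refl }) ,
    Sum.map (cong (2 +_)) (cong (2 +_)) x∈e′

  other-edge : ∀ {e x} → StripEdge e → x ∈ₑ e → OtherEdgeAt x e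
  other-edge e01 (inj₁ refl) = (0 , 2) , e02 , refl , (λ ()) , inj₁ refl
  other-edge e01 (inj₂ refl) = (1 , 2) , e12 , refl , (λ ()) , inj₁ refl
  other-edge e02 (inj₁ refl) = (0 , 1) , e01 , refl , (λ ()) , inj₁ refl
  other-edge e02 (inj₂ refl) = (1 , 2) , e12 , refl , (λ ()) , inj₂ refl
  other-edge e12 (inj₁ refl) = (0 , 1) , e01 , refl , (λ ()) , inj₂ refl
  other-edge e12 (inj₂ refl) = (0 , 2) , e02 , refl , (λ ()) , inj₂ refl
  other-edge (next e) (inj₁ refl) = other-edge-next (other-edge e (inj₁ refl))
  other-edge (next e) (inj₂ refl) = other-edge-next (other-edge e (inj₂ refl))

  Strip : ℕ → Graph
  Strip k = mkGraph (suc (k + k)) λ u v → isStripEdge (toℕ u) (toℕ v) ∨ isStripEdge (toℕ v) (toℕ u)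

  Strip-simple : ∀ k → IsSimple (Strip k)
  Strip-simple k = record
    { symm     = λ u v → ∨-comm (isStripEdge (toℕ u) (toℕ v)) _
    ; loopless = λ v → cong₂ _∨_ (isStripEdge-irrefl (toℕ v)) (isStripEdge-irrefl (toℕ v))
    }

  module _ (k : ℕ) where

    Strip-adj⁻ : ∀ {u v} → adj (Strip k) u v ≡ true → toℕ u < toℕ v → StripEdge (toℕ u , toℕ v)
    Strip-adj⁻ {u} {v} u~v u<v with isStripEdge (toℕ u) (toℕ v) in e
    ... | true  = isStripEdge-sound _ _ e
    ... | false = ⊥-elim (<-irrefl refl (<-trans u<v (StripEdge⇒< (isStripEdge-sound _ _ u~v))))

    Strip-adj⁺ : ∀ {u v} → StripEdge (toℕ u , toℕ v) → adj (Strip k) u v ≡ true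
    Strip-adj⁺ e rewrite isStripEdge-complete e = refl

  StripEdge-triangle< : ∀ {k c d} → StripEdge (c , d) → d < suc (k + k) → triangle c < k
  StripEdge-triangle< {k} e (s≤s d≤2k) = ≰⇒> λ k≤t →
    <-irrefl refl (≤-<-trans (+-mono-≤ k≤t k≤t) (≤-trans (proj₁ (StripEdge-bounds e)) d≤2k))

  triangle<⇒StripEdge< : ∀ {k c d} → StripEdge (c , d) → triangle c < k → d < suc (k + k)
  triangle<⇒StripEdge< {k} {c} e t<k = s≤s (≤-trans (proj₂ (StripEdge-bounds e))
    (≤-trans (≤-reflexive (cong suc (sym (+-suc t t)))) (+-mono-≤ t<k t<k)))
    where t = triangle c

  module _ (k : ℕ) where

    ends : Fin (n (lineGraph (Strip k))) → ℕ × ℕ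
    ends p = Product.map toℕ toℕ (edge (Strip k) p)

    ends-StripEdge : ∀ p → StripEdge (ends p)
    ends-StripEdge p = let lt , ad = edge-isEdge (Strip k) p in Strip-adj⁻ k ad lt

    ends-surjective : ∀ {e} → StripEdge e → proj₂ e < suc (k + k) → ∃ λ p → ends p ≡ e
    ends-surjective {c , d} e d<n = p , trans (cong (Product.map toℕ toℕ) edge-p≡uv) uv≡cd
      where
      c<n = <-trans (StripEdge⇒< e) d<n
      uv≡cd : (toℕ (fromℕ< c<n) , toℕ (fromℕ< d<n)) ≡ (c , d)
      uv≡cd = cong₂ _,_ (toℕ-fromℕ< c<n) (toℕ-fromℕ< d<n)
      e′ = subst StripEdge (sym uv≡cd) e
      p = proj₁ (edge-surjective (Strip k) (StripEdge⇒< e′ , Strip-adj⁺ k e′))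
      edge-p≡uv = proj₂ (edge-surjective (Strip k) (StripEdge⇒< e′ , Strip-adj⁺ k e′))

    label : Fin (n (lineGraph (Strip k))) → ℕ
    label p = triangle (proj₁ (ends p))

    label<k : ∀ p → label p < k
    label<k p = StripEdge-triangle< (ends-StripEdge p) (toℕ<n (proj₂ (edge (Strip k) p)))

    FortWitness : Fin (n (lineGraph (Strip k))) → Fin (n (lineGraph (Strip k))) → Set
    FortWitness v w = ∃ λ u → adj (lineGraph (Strip k)) v u ≡ true × u ≢ w × label u ≡ label w

    other-edge-at-meet : ∀ {v w x} → x ∈ₑ edge (Strip k) v → x ∈ₑ edge (Strip k) w →
                         label v ≢ label w → FortWitness v w
    other-edge-at-meet {v} {w} {x} x∈v x∈w lv≢lw =
      sibling (other-edge (ends-StripEdge w) (Sum.map (cong toℕ) (cong toℕ) x∈w))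
      where
      sibling : OtherEdgeAt (toℕ x) (ends w) → FortWitness v w
      sibling (e′ , e′-edge , same , e′≢w , x∈e′) =
        let u , ends-u = ends-surjective e′-edge
                           (triangle<⇒StripEdge< e′-edge (subst (_< k) (sym same) (label<k w)))
            lu≡lw = trans (cong (triangle ∘ proj₁) ends-u) same
            x∈u = Sum.map toℕ-injective toℕ-injective (subst (toℕ x ∈ₑ_) (sym ends-u) x∈e′)
            v≢u = λ v≡u → lv≢lw (trans (cong label v≡u) lu≡lw)
        in u , lineGraph-adj⁺ (Strip k) v u v≢u (x , x∈v , x∈u)
             , (λ u≡w → e′≢w (trans (sym ends-u) (cong ends u≡w))) , lu≡lw

    label-fort : ∀ i → IsFort (lineGraph (Strip k)) (λ p → label p ≡ i)
    label-fort i {v} {w} v~w refl lv≢i =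
      let _ , _ , x∈v , x∈w = lineGraph-adj⁻ (Strip k) v w v~w in other-edge-at-meet x∈v x∈w lv≢i

    label-surjective : ∀ {i} → i < k → ∃ λ p → label p ≡ i
    label-surjective {i} i<k =
      let p , ends-p = ends-surjective e (triangle<⇒StripEdge< e (subst (_< k) (sym (triangle-even i)) i<k))
      in p , trans (cong (triangle ∘ proj₁) ends-p) (triangle-even i)
      where e = proj₁ (triangle-edges i)

    k≤zero-forcing-number : ∀ {z} → IsZ (lineGraph (Strip k)) z → k ≤ z
    k≤zero-forcing-number ((_ , zfs , refl) , _) =
      zero-forcing-lower-bound (lineGraph (Strip k)) label k (λ {i} _ → label-fort i) label-surjective
        zfs

  module _ (k : ℕ) where

    adjacent-at : ∀ {u v a b} → toℕ u ≡ a → toℕ v ≡ b → StripEdge (a , b) → adj (Strip k) u v ≡ true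
    adjacent-at refl refl e = Strip-adj⁺ k e

    upper-neighbour : ∀ {v x j} → toℕ v ≡ j → j < toℕ x → adj (Strip k) v x ≡ true →
                      toℕ x ≤ suc (suc (triangle j + triangle j))
    upper-neighbour refl v<x v~x = proj₂ (StripEdge-bounds (Strip-adj⁻ k v~x v<x))

    TwoBrushesAt : ℕ → (Fin (n (Strip k)) → ℕ) → Set
    TwoBrushesAt j br = ∀ {v} → toℕ v ≡ j → 2 ≤ br v

    fire-last : ∀ {R br} → Above (k + k) R → Cleans (Strip k) R br
    fire-last {R} {br} above = fire R br v (proj₂ above (≤-reflexive (sym v≡))) (≤-trans dirty z≤n)
      (subst (λ S → Cleans (Strip k) S (swept (Strip k) R v br)) (sym (Above-n⇒⊥ (Above-remove above v≡)))
        (finish _))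
      where
      v = fromℕ< (n<1+n (k + k))
      v≡ = toℕ-fromℕ< (n<1+n (k + k))
      dirty = dirty-edges-bound (Strip k) (Strip-simple k) 0 above v≡ λ {x} _ _ → s≤s⁻¹ (toℕ<n x)

    -- Fire 2i, then 2i+1: their dirty edges reach at most 2i+2, which receives a brush from each.
    fire-triangle : ∀ {i R br} → i < k → Above (i + i) R → TwoBrushesAt (i + i) br →
                    (∀ {R′ br′} → Above (suc i + suc i) R′ → TwoBrushesAt (suc i + suc i) br′ →
                                  Cleans (Strip k) R′ br′) →
                    Cleans (Strip k) R br
    fire-triangle {i} {R} {br} i<k above two-at-j continue =
      fire R br v₀ (proj₂ above (≤-reflexive (sym v₀≡))) (≤-trans dirty₀ (two-at-j v₀≡))
        (fire R₁ br₁ v₁ (proj₂ above₁ (≤-reflexive (sym v₁≡))) (≤-trans dirty₁ one-at-1+j)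
          (continue above₂ two-at-2+j))
      where
      j = i + i
      e₀₁ = proj₁ (triangle-edges i)
      e₀₂ = proj₁ (proj₂ (triangle-edges i))
      e₁₂ = proj₂ (proj₂ (triangle-edges i))
      2+j<n : suc (suc j) < suc (k + k)
      2+j<n = triangle<⇒StripEdge< e₀₂ (subst (_< k) (sym (triangle-even i)) i<k)
      1+j<n = <-trans (n<1+n _) 2+j<n
      v₀ = fromℕ< (<-trans (n<1+n j) 1+j<n)
      v₀≡ = toℕ-fromℕ< (<-trans (n<1+n j) 1+j<n)
      v₁ = fromℕ< 1+j<n
      v₁≡ = toℕ-fromℕ< 1+j<n
      R₁ = R - v₀
      br₁ = swept (Strip k) R v₀ br
      above₁ = Above-remove above v₀≡
      above₂ : Above (suc i + suc i) (R₁ - v₁)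
      above₂ = subst (λ m → Above m (R₁ - v₁)) (sym (cong suc (+-suc i i))) (Above-remove above₁ v₁≡)
      dirty₀ = dirty-edges-bound (Strip k) (Strip-simple k) 2 above v₀≡ λ {x} j<x v₀~x →
        subst (λ t → toℕ x ≤ suc (suc (t + t))) (triangle-even i) (upper-neighbour v₀≡ j<x v₀~x)
      dirty₁ = dirty-edges-bound (Strip k) (Strip-simple k) 1 above₁ v₁≡ λ {x} j<x v₁~x →
        subst (λ t → toℕ x ≤ suc (suc (t + t))) (triangle-odd i) (upper-neighbour v₁≡ j<x v₁~x)
      one-at-1+j : 1 ≤ br₁ v₁
      one-at-1+j = subst (1 ≤_)
        (sym (swept-neighbour (Strip k) br (proj₂ above (subst (j ≤_) (sym v₁≡) (n≤1+n j)))
                                           (adjacent-at v₀≡ v₁≡ e₀₁)))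
        (s≤s z≤n)
      two-at-2+j : TwoBrushesAt (suc i + suc i) (swept (Strip k) R₁ v₁ br₁)
      two-at-2+j {v} v≡ = subst (2 ≤_) (sym swept-twice) (s≤s (s≤s z≤n))
        where
        v≡′ : toℕ v ≡ suc (suc j)
        v≡′ = trans v≡ (cong suc (+-suc i i))
        v∈R : v ∈ R
        v∈R = proj₂ above (subst (j ≤_) (sym v≡′) (≤-trans (n≤1+n j) (n≤1+n _)))
        v∈R₁ : v ∈ R₁
        v∈R₁ = proj₂ above₁ (subst (suc j ≤_) (sym v≡′) (n≤1+n _))
        swept-twice : swept (Strip k) R₁ v₁ br₁ v ≡ suc (suc (br v))
        swept-twice = trans (swept-neighbour (Strip k) br₁ v∈R₁ (adjacent-at v₁≡ v≡′ e₁₂))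
                            (cong suc (swept-neighbour (Strip k) br v∈R (adjacent-at v₀≡ v≡′ e₀₂)))

    cleans-from : ∀ r i → r + i ≡ k → ∀ {R br} → Above (i + i) R → TwoBrushesAt (i + i) br →
                  Cleans (Strip k) R br
    cleans-from zero    _ refl above _        = fire-last above
    cleans-from (suc r) i r+i≡k above two-at-j =
      fire-triangle (subst (i <_) r+i≡k (s≤s (m≤n+m i r))) above two-at-j
        (cleans-from r (suc i) (trans (+-suc r i) r+i≡k))

    two-brushes-at-0 : Fin (n (Strip k)) → ℕ
    two-brushes-at-0 zero    = 2
    two-brushes-at-0 (suc _) = 0

    two-brushes-at-0-cleans : CleansGraph (Strip k) two-brushes-at-0
    two-brushes-at-0-cleans = cleans-from k 0 (+-identityʳ k) Above-⊤ λ { {zero} _ → ≤-refl }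

    total-two-brushes-at-0 : total two-brushes-at-0 ≡ 2
    total-two-brushes-at-0 = cong (2 +_) (sum-zeros (k + k))
      where
      sum-zeros : ∀ m → Vec.sum (tabulate {m} λ _ → 0) ≡ 0
      sum-zeros zero    = refl
      sum-zeros (suc m) = sum-zeros m

    brush-number≤2 : ∀ {b} → IsB (Strip k) b → b ≤ 2
    brush-number≤2 {b} (_ , least) =
      subst (b ≤_) total-two-brushes-at-0 (least two-brushes-at-0 two-brushes-at-0-cleans)

open import Data.Nat using (ℕ)
open import Data.Integer using (+_)
open import Data.Rational using (ℚ; _/_; _≤_; _*_)
open import Data.Product using (Σ)
open import Relation.Nullary using (¬_)
open import Data.Nat as ℕ using (zero; suc; z≤n)
import Data.Nat.Properties as ℕ
open import Data.Integer as ℤ using (-[1+_]; +≤+; -≤+)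
import Data.Integer.Properties as ℤ
open import Data.Rational using (mkℚ; ↥_)
open import Data.Rational.Properties using (toℚᵘ-fromℚᵘ; toℚᵘ-homo-*; toℚᵘ-mono-≤)
open import Data.Rational.Unnormalised as ℚᵘ using (mkℚᵘ)
open import Data.Rational.Unnormalised.Properties
  using (≤-respˡ-≃; ≤-respʳ-≃; ≃-trans; ≃-refl; *-cong; drop-*≤*)
open import Data.Fin.Subset using (⊤; ∣_∣)
open import Data.Product using (_,_)
open import Relation.Binary.PropositionalEquality using (refl; sym)

i*n≤∣i∣*n : ∀ i n → i ℤ.* + n ℤ.≤ + (ℤ.∣ i ∣ ℕ.* n)
i*n≤∣i∣*n (+ m)    n       = ℤ.≤-reflexive (sym (ℤ.pos-* m n))
i*n≤∣i∣*n -[1+ m ] zero    = ℤ.≤-trans (ℤ.≤-reflexive (ℤ.*-zeroʳ -[1+ m ])) (+≤+ z≤n)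
i*n≤∣i∣*n -[1+ m ] (suc n) = -≤+

-- `+ z / 1` is normalised by a gcd that does not compute for a variable z, so the inequality is
-- read off in ℚᵘ.
z≤c*b⇒z≤∣↥c∣*b : ∀ (c : ℚ) z b → (+ z / 1) ≤ c * (+ b / 1) → z ℕ.≤ ℤ.∣ ↥ c ∣ ℕ.* b
z≤c*b⇒z≤∣↥c∣*b c@(mkℚ num den-1 _) z b z≤cb =
  ℕ.≤-trans (ℕ.m≤m*n z (suc (den-1 ℕ.* 1))) (ℤ.drop‿+≤+ (begin
    + (z ℕ.* suc (den-1 ℕ.* 1)) ≡⟨ ℤ.pos-* z _ ⟩
    + z ℤ.* + suc (den-1 ℕ.* 1) ≤⟨ drop-*≤* unnormalised ⟩
    num ℤ.* + b ℤ.* + 1         ≡⟨ ℤ.*-identityʳ _ ⟩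
    num ℤ.* + b                 ≤⟨ i*n≤∣i∣*n num b ⟩
    + (ℤ.∣ num ∣ ℕ.* b)         ∎))
  where
  open ℤ.≤-Reasoning
  unnormalised : mkℚᵘ (+ z) 0 ℚᵘ.≤ mkℚᵘ num den-1 ℚᵘ.* mkℚᵘ (+ b) 0
  unnormalised = ≤-respˡ-≃ (toℚᵘ-fromℚᵘ _)
    (≤-respʳ-≃ (≃-trans (toℚᵘ-homo-* c (+ b / 1)) (*-cong (≃-refl {mkℚᵘ num den-1}) (toℚᵘ-fromℚᵘ _)))
      (toℚᵘ-mono-≤ z≤cb))

theorem3 : ¬ Σ ℚ (λ c → (G : Graph) → IsSimple G → (z b : ℕ) →
    IsZ (lineGraph G) z → IsB G b → (+ z / 1) ≤ c * (+ b / 1))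
theorem3 (c , bounded) =
  ¬¬-minimum (IsZeroForcingSet L) ∣_∣ (done ⊤) λ (z , isZ) →
  ¬¬-minimum (CleansGraph G) total (two-brushes-at-0-cleans k) λ (b , isB) →
  ℕ.<-irrefl refl (ℕ.<-≤-trans (k≤zero-forcing-number k isZ) (ℕ.≤-trans
    (z≤c*b⇒z≤∣↥c∣*b c z b (bounded G (Strip-simple k) z b isZ isB))
    (ℕ.*-monoʳ-≤ m (brush-number≤2 k isB))))
  where
  m = ℤ.∣ ↥ c ∣
  k = suc (m ℕ.* 2)
  G = Strip k
  L = lineGraph G
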